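{- Let $\mathcal{C}$ be a category with finite coproducts $(0,+)$ and a symmetric monoidal structure $(I,\otimes)$ such that $\otimes$ distributes over coproducts. Call a map $s\colon I\to I+I$ with $\nabla\circ s=\mathrm{id}_I$ a probability, and for probabilities $s,t$ define $s\cdot t=[s,\kappa_2]\circ t\colon I\to I+I$. Then for all probabilities $s,t$ we have $s\cdot t=t\cdot s$.
   Context: Notation: $\kappa_1,\kappa_2$ are the coprojections, $[f,g]$ is the cotuple, and $\nabla=[\mathrm{id},\mathrm{id}]$. Distributivity means that the canonical maps $[\kappa_1\otimes\mathrm{id},\kappa_2\otimes\mathrm{id}]\colon (X\otimes Z)+(Y\otimes Z)\to(X+Y)\otimes Z$ and $0\to 0\otimes Z$ are isomorphisms. (In a dagger setting, the positive probabilities, i.e. the positive predicates on $I$, form a subset of the probabilities, with the same multiplication.) -}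

module Defs where

open import Level using (Level; _⊔_; suc)
open import Data.Product using (Σ; _×_; _,_)
open import Relation.Binary.PropositionalEquality using (_≡_)

record Category (o ℓ : Level) : Set (suc (o ⊔ ℓ)) where
  infixr 9 _∘_
  field
    Obj : Set o
    Hom : Obj → Obj → Set ℓ
    id  : ∀ {A} → Hom A A
    _∘_ : ∀ {A B C} → Hom B C → Hom A B → Hom A C
    identityˡ : ∀ {A B} {f : Hom A B} → id ∘ f ≡ f
    identityʳ : ∀ {A B} {f : Hom A B} → f ∘ id ≡ f
    assoc : ∀ {A B C D} {f : Hom A B} {g : Hom B C} {h : Hom C D} →
            (h ∘ g) ∘ f ≡ h ∘ (g ∘ f)

  IsIso : ∀ {A B} → Hom A B → Set ℓ
  IsIso {A} {B} f = Σ (Hom B A) λ g → (g ∘ f ≡ id) × (f ∘ g ≡ id)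

record FiniteCoproducts {o ℓ} (C : Category o ℓ) : Set (o ⊔ ℓ) where
  open Category C
  infixr 6 _+_
  field
    𝟘 : Obj
    ¡ : ∀ {A} → Hom 𝟘 A
    ¡-unique : ∀ {A} (f : Hom 𝟘 A) → f ≡ ¡
    _+_ : Obj → Obj → Obj
    κ₁ : ∀ {A B} → Hom A (A + B)
    κ₂ : ∀ {A B} → Hom B (A + B)
    [_,_] : ∀ {A B X} → Hom A X → Hom B X → Hom (A + B) X
    inject₁ : ∀ {A B X} {f : Hom A X} {g : Hom B X} → [ f , g ] ∘ κ₁ ≡ f
    inject₂ : ∀ {A B X} {f : Hom A X} {g : Hom B X} → [ f , g ] ∘ κ₂ ≡ g
    []-unique : ∀ {A B X} {f : Hom A X} {g : Hom B X} {h : Hom (A + B) X} →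
                h ∘ κ₁ ≡ f → h ∘ κ₂ ≡ g → h ≡ [ f , g ]

  ∇ : ∀ {A} → Hom (A + A) A
  ∇ = [ id , id ]

record SymmetricMonoidal {o ℓ} (C : Category o ℓ) : Set (o ⊔ ℓ) where
  open Category C
  infixr 10 _⊗₀_ _⊗₁_
  field
    I : Obj
    _⊗₀_ : Obj → Obj → Obj
    _⊗₁_ : ∀ {A B X Y} → Hom A B → Hom X Y → Hom (A ⊗₀ X) (B ⊗₀ Y)
    ⊗-identity : ∀ {A X} → id {A} ⊗₁ id {X} ≡ id
    ⊗-homomorphism : ∀ {A B D X Y Z} {f : Hom A B} {g : Hom B D}
                       {h : Hom X Y} {k : Hom Y Z} →
                     (g ∘ f) ⊗₁ (k ∘ h) ≡ (g ⊗₁ k) ∘ (f ⊗₁ h)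
    α⇒ : ∀ {A B D} → Hom ((A ⊗₀ B) ⊗₀ D) (A ⊗₀ (B ⊗₀ D))
    α⇐ : ∀ {A B D} → Hom (A ⊗₀ (B ⊗₀ D)) ((A ⊗₀ B) ⊗₀ D)
    α-isoˡ : ∀ {A B D} → α⇐ {A} {B} {D} ∘ α⇒ ≡ id
    α-isoʳ : ∀ {A B D} → α⇒ {A} {B} {D} ∘ α⇐ ≡ id
    α-natural : ∀ {A A' B B' D D'} {f : Hom A A'} {g : Hom B B'} {h : Hom D D'} →
                α⇒ ∘ ((f ⊗₁ g) ⊗₁ h) ≡ (f ⊗₁ (g ⊗₁ h)) ∘ α⇒
    λ⇒ : ∀ {A} → Hom (I ⊗₀ A) A
    λ⇐ : ∀ {A} → Hom A (I ⊗₀ A)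
    λ-isoˡ : ∀ {A} → λ⇐ {A} ∘ λ⇒ ≡ id
    λ-isoʳ : ∀ {A} → λ⇒ {A} ∘ λ⇐ ≡ id
    λ-natural : ∀ {A B} {f : Hom A B} → λ⇒ ∘ (id ⊗₁ f) ≡ f ∘ λ⇒
    ρ⇒ : ∀ {A} → Hom (A ⊗₀ I) A
    ρ⇐ : ∀ {A} → Hom A (A ⊗₀ I)
    ρ-isoˡ : ∀ {A} → ρ⇐ {A} ∘ ρ⇒ ≡ id
    ρ-isoʳ : ∀ {A} → ρ⇒ {A} ∘ ρ⇐ ≡ id
    ρ-natural : ∀ {A B} {f : Hom A B} → ρ⇒ ∘ (f ⊗₁ id) ≡ f ∘ ρ⇒
    triangle : ∀ {A B} → (id {A} ⊗₁ λ⇒ {B}) ∘ α⇒ ≡ ρ⇒ ⊗₁ id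
    pentagon : ∀ {A B D E} →
               (id {A} ⊗₁ α⇒ {B} {D} {E}) ∘ α⇒ ∘ (α⇒ ⊗₁ id) ≡ α⇒ ∘ α⇒
    σ : ∀ {A B} → Hom (A ⊗₀ B) (B ⊗₀ A)
    σ-natural : ∀ {A A' B B'} {f : Hom A A'} {g : Hom B B'} →
                σ ∘ (f ⊗₁ g) ≡ (g ⊗₁ f) ∘ σ
    σ-involutive : ∀ {A B} → σ {B} {A} ∘ σ {A} {B} ≡ id
    hexagon : ∀ {A B D} →
              α⇒ ∘ σ ∘ α⇒ ≡ (id {B} ⊗₁ σ {A} {D}) ∘ α⇒ ∘ (σ ⊗₁ id)

record Distributive {o ℓ} (C : Category o ℓ) (K : FiniteCoproducts C)
                    (M : SymmetricMonoidal C) : Set (o ⊔ ℓ) where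
  open Category C
  open FiniteCoproducts K
  open SymmetricMonoidal M
  field
    dist-+ : ∀ {X Y Z} → IsIso ([ κ₁ {X} {Y} ⊗₁ id {Z} , κ₂ {X} {Y} ⊗₁ id {Z} ])
    dist-0 : ∀ {Z} → IsIso (¡ {𝟘 ⊗₀ Z})

module _ {o ℓ} (C : Category o ℓ) (K : FiniteCoproducts C) where
  open Category C
  open FiniteCoproducts K

  IsProbability : (I : Obj) → Hom I (I + I) → Set ℓ
  IsProbability I s = ∇ ∘ s ≡ id

  prob-mul : {I : Obj} → Hom I (I + I) → Hom I (I + I) → Hom I (I + I)
  prob-mul s t = [ s , κ₂ ] ∘ t

-- Distributivity lets us define a map  Φ : (I + I) ⊗ (I + I) → I + I
-- by cases on the left factor:  Φ (κ₁ ⊗ x) = x  and  Φ (κ₂ ⊗ x) = κ₂.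
-- Plugging a state into one slot of Φ gives an endomap of I + I:
--   plugˡ Φ s = Φ ∘ (s ⊗ id) ∘ λ⁻¹   and   plugʳ Φ t = Φ ∘ (id ⊗ t) ∘ ρ⁻¹ .
-- For ANY Ψ : A ⊗ B → D and states s : I → A, t : I → B there is the
-- exchange law   plugˡ Ψ s ∘ t = Ψ ∘ (s ⊗ t) ∘ λ⁻¹ = plugʳ Ψ t ∘ s ,
-- which rests on λ and ρ coinciding on I (Kelly's lemma).  The values of
-- plugˡ Φ on the coprojections are immediate from the definition of Φ; the
-- exchange law transfers them to plugʳ Φ, and from these four values one
-- reads off  plugˡ Φ s = [ s , κ₂ ]  and  plugʳ Φ t = [ t , κ₂ ]  for
-- probabilities s, t.  Hence
--   s · t = [ s , κ₂ ] ∘ t = plugˡ Φ s ∘ t = plugʳ Φ t ∘ s = t · s .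

module Submission where

open import Defs
open import Level using (Level)
open import Relation.Binary.PropositionalEquality using (_≡_; refl; sym; trans; cong; cong₂; module ≡-Reasoning)
open import Data.Product using (proj₁; proj₂)

module CategoryFacts {o ℓ} (C : Category o ℓ) where
  open Category C
  open ≡-Reasoning

  cancelʳ : ∀ {A B X} {f : Hom A B} {g : Hom B A} {h k : Hom B X} →
            f ∘ g ≡ id → h ∘ f ≡ k ∘ f → h ≡ k
  cancelʳ {f = f} {g} {h} {k} fg e = begin
    h             ≡⟨ sym identityʳ ⟩
    h ∘ id        ≡⟨ cong (h ∘_) (sym fg) ⟩
    h ∘ (f ∘ g)   ≡⟨ sym assoc ⟩
    (h ∘ f) ∘ g   ≡⟨ cong (_∘ g) e ⟩
    (k ∘ f) ∘ g   ≡⟨ assoc ⟩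
    k ∘ (f ∘ g)   ≡⟨ cong (k ∘_) fg ⟩
    k ∘ id        ≡⟨ identityʳ ⟩
    k             ∎

  cancelˡ : ∀ {A B X} {f : Hom A B} {g : Hom B A} {h k : Hom X A} →
            g ∘ f ≡ id → f ∘ h ≡ f ∘ k → h ≡ k
  cancelˡ {f = f} {g} {h} {k} gf e = begin
    h             ≡⟨ sym identityˡ ⟩
    id ∘ h        ≡⟨ cong (_∘ h) (sym gf) ⟩
    (g ∘ f) ∘ h   ≡⟨ assoc ⟩
    g ∘ (f ∘ h)   ≡⟨ cong (g ∘_) e ⟩
    g ∘ (f ∘ k)   ≡⟨ sym assoc ⟩
    (g ∘ f) ∘ k   ≡⟨ cong (_∘ k) gf ⟩
    id ∘ k        ≡⟨ identityˡ ⟩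
    k             ∎

  inverse-unique : ∀ {A B} {f : Hom A B} {g h : Hom B A} → g ∘ f ≡ id → f ∘ h ≡ id → g ≡ h
  inverse-unique {f = f} {g} {h} gf fh = begin
    g             ≡⟨ sym identityʳ ⟩
    g ∘ id        ≡⟨ cong (g ∘_) (sym fh) ⟩
    g ∘ (f ∘ h)   ≡⟨ sym assoc ⟩
    (g ∘ f) ∘ h   ≡⟨ cong (_∘ h) gf ⟩
    id ∘ h        ≡⟨ identityˡ ⟩
    h             ∎

  inverse-natural : ∀ {X Y X' Y'} {u : Hom X Y} {v : Hom Y X} {u' : Hom X' Y'} {v' : Hom Y' X'}
                      {F : Hom X X'} {G : Hom Y Y'} →
                    v' ∘ u' ≡ id → u ∘ v ≡ id → u' ∘ F ≡ G ∘ u → F ∘ v ≡ v' ∘ G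
  inverse-natural {u = u} {v} {u'} {v'} {F} {G} vu uv e = begin
    F ∘ v                   ≡⟨ sym identityˡ ⟩
    id ∘ (F ∘ v)            ≡⟨ cong (_∘ (F ∘ v)) (sym vu) ⟩
    (v' ∘ u') ∘ (F ∘ v)     ≡⟨ assoc ⟩
    v' ∘ (u' ∘ (F ∘ v))     ≡⟨ cong (v' ∘_) (sym assoc) ⟩
    v' ∘ ((u' ∘ F) ∘ v)     ≡⟨ cong (λ x → v' ∘ (x ∘ v)) e ⟩
    v' ∘ ((G ∘ u) ∘ v)      ≡⟨ cong (v' ∘_) assoc ⟩
    v' ∘ (G ∘ (u ∘ v))      ≡⟨ cong (λ x → v' ∘ (G ∘ x)) uv ⟩
    v' ∘ (G ∘ id)           ≡⟨ cong (v' ∘_) identityʳ ⟩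
    v' ∘ G                  ∎

module CoproductFacts {o ℓ} (C : Category o ℓ) (K : FiniteCoproducts C) where
  open Category C
  open FiniteCoproducts K

  +-ext : ∀ {A B X} {h k : Hom (A + B) X} → h ∘ κ₁ ≡ k ∘ κ₁ → h ∘ κ₂ ≡ k ∘ κ₂ → h ≡ k
  +-ext e₁ e₂ = trans ([]-unique e₁ e₂) (sym ([]-unique refl refl))

  fail-absorbs : ∀ {A B} {p : Hom A (A + A)} → ∇ ∘ p ≡ id → (κ₂ {B} ∘ ∇) ∘ p ≡ κ₂
  fail-absorbs {p = p} ∇p = trans assoc (trans (cong (κ₂ ∘_) ∇p) identityʳ)

module MonoidalFacts {o ℓ} (C : Category o ℓ) (M : SymmetricMonoidal C) where
  open Category C
  open SymmetricMonoidal M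
  open CategoryFacts C
  open ≡-Reasoning

  ⊗ˡ-∘ : ∀ {A B X Z} {f : Hom B X} {g : Hom A B} → (f ∘ g) ⊗₁ id {Z} ≡ (f ⊗₁ id) ∘ (g ⊗₁ id)
  ⊗ˡ-∘ {f = f} {g} = trans (cong ((f ∘ g) ⊗₁_) (sym identityˡ)) ⊗-homomorphism

  ⊗ʳ-∘ : ∀ {A B X Z} {f : Hom B X} {g : Hom A B} → id {Z} ⊗₁ (f ∘ g) ≡ (id ⊗₁ f) ∘ (id ⊗₁ g)
  ⊗ʳ-∘ {f = f} {g} = trans (cong (_⊗₁ (f ∘ g)) (sym identityˡ)) ⊗-homomorphism

  ⊗-split : ∀ {A B X Y} {f : Hom A B} {g : Hom X Y} → (f ⊗₁ id) ∘ (id ⊗₁ g) ≡ f ⊗₁ g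
  ⊗-split = trans (sym ⊗-homomorphism) (cong₂ _⊗₁_ identityʳ identityˡ)

  ⊗-split′ : ∀ {A B X Y} {f : Hom A B} {g : Hom X Y} → (id ⊗₁ g) ∘ (f ⊗₁ id) ≡ f ⊗₁ g
  ⊗-split′ = trans (sym ⊗-homomorphism) (cong₂ _⊗₁_ identityˡ identityʳ)

  faithˡ : ∀ {A B} {f g : Hom A B} → id {I} ⊗₁ f ≡ id ⊗₁ g → f ≡ g
  faithˡ e = cancelʳ λ-isoʳ (trans (sym λ-natural) (trans (cong (λ⇒ ∘_) e) λ-natural))

  faithʳ : ∀ {A B} {f g : Hom A B} → f ⊗₁ id {I} ≡ g ⊗₁ id → f ≡ g
  faithʳ e = cancelʳ ρ-isoʳ (trans (sym ρ-natural) (trans (cong (ρ⇒ ∘_) e) ρ-natural))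

  λ⇐-natural : ∀ {A B} {f : Hom A B} → (id ⊗₁ f) ∘ λ⇐ ≡ λ⇐ ∘ f
  λ⇐-natural = inverse-natural λ-isoˡ λ-isoʳ λ-natural

  ρ⇐-natural : ∀ {A B} {f : Hom A B} → (f ⊗₁ id) ∘ ρ⇐ ≡ ρ⇐ ∘ f
  ρ⇐-natural = inverse-natural ρ-isoˡ ρ-isoʳ ρ-natural

  -- After tensoring with I on the left and precomposing with two invertible
  -- associators, both sides agree by the pentagon and the triangle.
  λ-assoc : ∀ {A B} → λ⇒ {A ⊗₀ B} ∘ α⇒ {I} {A} {B} ≡ λ⇒ {A} ⊗₁ id {B}
  λ-assoc {A} {B} = faithˡ (cancelʳ {f = α⇒ {I} {I ⊗₀ A} {B}} α-isoʳ
                      (cancelʳ {f = α⇒ {I} {I} {A} ⊗₁ id {B}} α⊗id-isoʳ pentagon-triangle))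
    where
    α⊗id-isoʳ : (α⇒ {I} {I} {A} ⊗₁ id {B}) ∘ (α⇐ ⊗₁ id) ≡ id
    α⊗id-isoʳ = trans (sym ⊗ˡ-∘) (trans (cong (_⊗₁ id) α-isoʳ) ⊗-identity)
    pentagon-triangle : ((id {I} ⊗₁ (λ⇒ {A ⊗₀ B} ∘ α⇒ {I} {A} {B})) ∘ α⇒) ∘ (α⇒ {I} {I} {A} ⊗₁ id {B})
                      ≡ ((id ⊗₁ (λ⇒ {A} ⊗₁ id {B})) ∘ α⇒) ∘ (α⇒ ⊗₁ id)
    pentagon-triangle = begin
      ((id ⊗₁ (λ⇒ ∘ α⇒)) ∘ α⇒) ∘ (α⇒ ⊗₁ id)           ≡⟨ assoc ⟩
      (id ⊗₁ (λ⇒ ∘ α⇒)) ∘ (α⇒ ∘ (α⇒ ⊗₁ id))           ≡⟨ cong (_∘ (α⇒ ∘ (α⇒ ⊗₁ id))) ⊗ʳ-∘ ⟩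
      ((id ⊗₁ λ⇒) ∘ (id ⊗₁ α⇒)) ∘ (α⇒ ∘ (α⇒ ⊗₁ id))   ≡⟨ assoc ⟩
      (id ⊗₁ λ⇒) ∘ ((id ⊗₁ α⇒) ∘ (α⇒ ∘ (α⇒ ⊗₁ id)))   ≡⟨ cong ((id ⊗₁ λ⇒) ∘_) pentagon ⟩
      (id ⊗₁ λ⇒) ∘ (α⇒ ∘ α⇒)                           ≡⟨ sym assoc ⟩
      ((id ⊗₁ λ⇒) ∘ α⇒) ∘ α⇒                           ≡⟨ cong (_∘ α⇒) triangle ⟩
      (ρ⇒ ⊗₁ id) ∘ α⇒                                   ≡⟨ cong (λ x → (ρ⇒ ⊗₁ x) ∘ α⇒) (sym ⊗-identity) ⟩
      (ρ⇒ ⊗₁ (id ⊗₁ id)) ∘ α⇒                           ≡⟨ sym α-natural ⟩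
      α⇒ ∘ ((ρ⇒ ⊗₁ id) ⊗₁ id)                           ≡⟨ cong (λ x → α⇒ ∘ (x ⊗₁ id)) (sym triangle) ⟩
      α⇒ ∘ (((id ⊗₁ λ⇒) ∘ α⇒) ⊗₁ id)                   ≡⟨ cong (α⇒ ∘_) ⊗ˡ-∘ ⟩
      α⇒ ∘ (((id ⊗₁ λ⇒) ⊗₁ id) ∘ (α⇒ ⊗₁ id))           ≡⟨ sym assoc ⟩
      (α⇒ ∘ ((id ⊗₁ λ⇒) ⊗₁ id)) ∘ (α⇒ ⊗₁ id)           ≡⟨ cong (_∘ (α⇒ ⊗₁ id)) α-natural ⟩
      ((id ⊗₁ (λ⇒ ⊗₁ id)) ∘ α⇒) ∘ (α⇒ ⊗₁ id)           ∎

  -- On I ⊗ I the left unitor is I ⊗ λ_I (naturality of λ at λ_I, cancelling λ_I).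
  λ-I⊗I : λ⇒ {I ⊗₀ I} ≡ id ⊗₁ λ⇒ {I}
  λ-I⊗I = cancelˡ {f = λ⇒ {I}} λ-isoˡ (sym λ-natural)

  kelly : λ⇒ {I} ≡ ρ⇒ {I}
  kelly = faithʳ (begin
    λ⇒ ⊗₁ id                ≡⟨ sym λ-assoc ⟩
    λ⇒ {I ⊗₀ I} ∘ α⇒        ≡⟨ cong (_∘ α⇒) λ-I⊗I ⟩
    (id ⊗₁ λ⇒) ∘ α⇒         ≡⟨ triangle ⟩
    ρ⇒ ⊗₁ id                ∎)

  kelly⇐ : λ⇐ {I} ≡ ρ⇐ {I}
  kelly⇐ = inverse-unique λ-isoˡ (trans (cong (_∘ ρ⇐) kelly) ρ-isoʳ)

  plugˡ : ∀ {A B D} → Hom (A ⊗₀ B) D → Hom I A → Hom B D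
  plugˡ Ψ s = Ψ ∘ (s ⊗₁ id) ∘ λ⇐

  plugʳ : ∀ {A B D} → Hom (A ⊗₀ B) D → Hom I B → Hom A D
  plugʳ Ψ t = Ψ ∘ (id ⊗₁ t) ∘ ρ⇐

  plugˡ-∘ : ∀ {A B D} (Ψ : Hom (A ⊗₀ B) D) (s : Hom I A) (t : Hom I B) →
            plugˡ Ψ s ∘ t ≡ Ψ ∘ (s ⊗₁ t) ∘ λ⇐
  plugˡ-∘ Ψ s t = begin
    (Ψ ∘ (s ⊗₁ id) ∘ λ⇐) ∘ t              ≡⟨ assoc ⟩
    Ψ ∘ ((s ⊗₁ id) ∘ λ⇐) ∘ t              ≡⟨ cong (Ψ ∘_) assoc ⟩
    Ψ ∘ (s ⊗₁ id) ∘ λ⇐ ∘ t                ≡⟨ cong (λ x → Ψ ∘ (s ⊗₁ id) ∘ x) (sym λ⇐-natural) ⟩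
    Ψ ∘ (s ⊗₁ id) ∘ (id ⊗₁ t) ∘ λ⇐        ≡⟨ cong (Ψ ∘_) (sym assoc) ⟩
    Ψ ∘ ((s ⊗₁ id) ∘ (id ⊗₁ t)) ∘ λ⇐      ≡⟨ cong (λ x → Ψ ∘ x ∘ λ⇐) ⊗-split ⟩
    Ψ ∘ (s ⊗₁ t) ∘ λ⇐                     ∎

  plugʳ-∘ : ∀ {A B D} (Ψ : Hom (A ⊗₀ B) D) (s : Hom I A) (t : Hom I B) →
            plugʳ Ψ t ∘ s ≡ Ψ ∘ (s ⊗₁ t) ∘ ρ⇐
  plugʳ-∘ Ψ s t = begin
    (Ψ ∘ (id ⊗₁ t) ∘ ρ⇐) ∘ s              ≡⟨ assoc ⟩
    Ψ ∘ ((id ⊗₁ t) ∘ ρ⇐) ∘ s              ≡⟨ cong (Ψ ∘_) assoc ⟩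
    Ψ ∘ (id ⊗₁ t) ∘ ρ⇐ ∘ s                ≡⟨ cong (λ x → Ψ ∘ (id ⊗₁ t) ∘ x) (sym ρ⇐-natural) ⟩
    Ψ ∘ (id ⊗₁ t) ∘ (s ⊗₁ id) ∘ ρ⇐        ≡⟨ cong (Ψ ∘_) (sym assoc) ⟩
    Ψ ∘ ((id ⊗₁ t) ∘ (s ⊗₁ id)) ∘ ρ⇐      ≡⟨ cong (λ x → Ψ ∘ x ∘ ρ⇐) ⊗-split′ ⟩
    Ψ ∘ (s ⊗₁ t) ∘ ρ⇐                     ∎

  -- Exchange law: plugging s then applying to t equals plugging t then applying
  -- to s; the two unitors involved agree on I by Kelly's lemma.
  exchange : ∀ {A B D} (Ψ : Hom (A ⊗₀ B) D) (s : Hom I A) (t : Hom I B) →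
             plugˡ Ψ s ∘ t ≡ plugʳ Ψ t ∘ s
  exchange Ψ s t = begin
    plugˡ Ψ s ∘ t          ≡⟨ plugˡ-∘ Ψ s t ⟩
    Ψ ∘ (s ⊗₁ t) ∘ λ⇐      ≡⟨ cong (λ x → Ψ ∘ (s ⊗₁ t) ∘ x) kelly⇐ ⟩
    Ψ ∘ (s ⊗₁ t) ∘ ρ⇐      ≡⟨ sym (plugʳ-∘ Ψ s t) ⟩
    plugʳ Ψ t ∘ s          ∎

module Cases {o ℓ} (C : Category o ℓ) (K : FiniteCoproducts C) (M : SymmetricMonoidal C)
             (Dist : Distributive C K M) where
  open Category C
  open FiniteCoproducts K
  open SymmetricMonoidal M
  open Distributive Dist
  open MonoidalFacts C M using (plugˡ)
  open ≡-Reasoning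

  distr : ∀ {X Y Z} → Hom ((X ⊗₀ Z) + (Y ⊗₀ Z)) ((X + Y) ⊗₀ Z)
  distr = [ κ₁ ⊗₁ id , κ₂ ⊗₁ id ]

  copair : ∀ {X Y Z W} → Hom (X ⊗₀ Z) W → Hom (Y ⊗₀ Z) W → Hom ((X + Y) ⊗₀ Z) W
  copair h₁ h₂ = [ h₁ , h₂ ] ∘ proj₁ dist-+

  copair-distr : ∀ {X Y Z W} {h₁ : Hom (X ⊗₀ Z) W} {h₂ : Hom (Y ⊗₀ Z) W} →
                 copair h₁ h₂ ∘ distr ≡ [ h₁ , h₂ ]
  copair-distr {h₁ = h₁} {h₂} = begin
    ([ h₁ , h₂ ] ∘ proj₁ dist-+) ∘ distr   ≡⟨ assoc ⟩
    [ h₁ , h₂ ] ∘ (proj₁ dist-+ ∘ distr)   ≡⟨ cong ([ h₁ , h₂ ] ∘_) (proj₁ (proj₂ dist-+)) ⟩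
    [ h₁ , h₂ ] ∘ id                       ≡⟨ identityʳ ⟩
    [ h₁ , h₂ ]                            ∎

  copair-κ₁ : ∀ {X Y Z W} {h₁ : Hom (X ⊗₀ Z) W} {h₂ : Hom (Y ⊗₀ Z) W} →
              copair h₁ h₂ ∘ (κ₁ ⊗₁ id) ≡ h₁
  copair-κ₁ {h₁ = h₁} {h₂} = begin
    copair h₁ h₂ ∘ (κ₁ ⊗₁ id)     ≡⟨ cong (copair h₁ h₂ ∘_) (sym inject₁) ⟩
    copair h₁ h₂ ∘ (distr ∘ κ₁)   ≡⟨ sym assoc ⟩
    (copair h₁ h₂ ∘ distr) ∘ κ₁   ≡⟨ cong (_∘ κ₁) copair-distr ⟩
    [ h₁ , h₂ ] ∘ κ₁              ≡⟨ inject₁ ⟩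
    h₁                            ∎

  copair-κ₂ : ∀ {X Y Z W} {h₁ : Hom (X ⊗₀ Z) W} {h₂ : Hom (Y ⊗₀ Z) W} →
              copair h₁ h₂ ∘ (κ₂ ⊗₁ id) ≡ h₂
  copair-κ₂ {h₁ = h₁} {h₂} = begin
    copair h₁ h₂ ∘ (κ₂ ⊗₁ id)     ≡⟨ cong (copair h₁ h₂ ∘_) (sym inject₂) ⟩
    copair h₁ h₂ ∘ (distr ∘ κ₂)   ≡⟨ sym assoc ⟩
    (copair h₁ h₂ ∘ distr) ∘ κ₂   ≡⟨ cong (_∘ κ₂) copair-distr ⟩
    [ h₁ , h₂ ] ∘ κ₂              ≡⟨ inject₂ ⟩
    h₂                            ∎

  -- "If the left factor is κ₁ then f else g":  cases f g (κᵢ ⊗ b) = f b / g b.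
  cases : ∀ {B D} → Hom B D → Hom B D → Hom ((I + I) ⊗₀ B) D
  cases f g = copair (f ∘ λ⇒) (g ∘ λ⇒)

  cases-branch : ∀ {B D} {f g : Hom B D} {κ : Hom I (I + I)} {h : Hom B D} →
                 cases f g ∘ (κ ⊗₁ id) ≡ h ∘ λ⇒ → plugˡ (cases f g) κ ≡ h
  cases-branch {f = f} {g} {κ} {h} restrict = begin
    cases f g ∘ (κ ⊗₁ id) ∘ λ⇐       ≡⟨ sym assoc ⟩
    (cases f g ∘ (κ ⊗₁ id)) ∘ λ⇐     ≡⟨ cong (_∘ λ⇐) restrict ⟩
    (h ∘ λ⇒) ∘ λ⇐                    ≡⟨ assoc ⟩
    h ∘ (λ⇒ ∘ λ⇐)                    ≡⟨ cong (h ∘_) λ-isoʳ ⟩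
    h ∘ id                           ≡⟨ identityʳ ⟩
    h                                ∎

  cases-κ₁ : ∀ {B D} {f g : Hom B D} → plugˡ (cases f g) κ₁ ≡ f
  cases-κ₁ = cases-branch copair-κ₁

  cases-κ₂ : ∀ {B D} {f g : Hom B D} → plugˡ (cases f g) κ₂ ≡ g
  cases-κ₂ = cases-branch copair-κ₂

-- The sequential product  Φ = cases id (κ₂ ∘ ∇) : (I + I) ⊗ (I + I) → I + I
-- ("continue with the right factor if the left succeeds, fail otherwise")
-- represents the multiplication of probabilities from either side.
module Product {o ℓ} (C : Category o ℓ) (K : FiniteCoproducts C) (M : SymmetricMonoidal C)
               (Dist : Distributive C K M) where
  open Category C
  open FiniteCoproducts K
  open SymmetricMonoidal M using (I; _⊗₀_)
  open CoproductFacts C K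
  open MonoidalFacts C M using (plugˡ; plugʳ; exchange)
  open Cases C K M Dist using (cases; cases-κ₁; cases-κ₂)
  open ≡-Reasoning

  Φ : Hom ((I + I) ⊗₀ (I + I)) (I + I)
  Φ = cases id (κ₂ ∘ ∇)

  -- The right slot of Φ on the coprojections, computed from the left slot by exchange.
  plugʳ-κ₁ : plugʳ Φ κ₁ ≡ id
  plugʳ-κ₁ = +-ext
    (begin
      plugʳ Φ κ₁ ∘ κ₁   ≡⟨ sym (exchange Φ κ₁ κ₁) ⟩
      plugˡ Φ κ₁ ∘ κ₁   ≡⟨ cong (_∘ κ₁) cases-κ₁ ⟩
      id ∘ κ₁           ∎)
    (begin
      plugʳ Φ κ₁ ∘ κ₂   ≡⟨ sym (exchange Φ κ₂ κ₁) ⟩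
      plugˡ Φ κ₂ ∘ κ₁   ≡⟨ cong (_∘ κ₁) cases-κ₂ ⟩
      (κ₂ ∘ ∇) ∘ κ₁     ≡⟨ fail-absorbs inject₁ ⟩
      κ₂                ≡⟨ sym identityˡ ⟩
      id ∘ κ₂           ∎)

  plugʳ-κ₂ : plugʳ Φ κ₂ ≡ κ₂ ∘ ∇
  plugʳ-κ₂ = +-ext
    (begin
      plugʳ Φ κ₂ ∘ κ₁   ≡⟨ sym (exchange Φ κ₁ κ₂) ⟩
      plugˡ Φ κ₁ ∘ κ₂   ≡⟨ cong (_∘ κ₂) cases-κ₁ ⟩
      id ∘ κ₂           ≡⟨ identityˡ ⟩
      κ₂                ≡⟨ sym (fail-absorbs inject₁) ⟩
      (κ₂ ∘ ∇) ∘ κ₁     ∎)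
    (begin
      plugʳ Φ κ₂ ∘ κ₂   ≡⟨ sym (exchange Φ κ₂ κ₂) ⟩
      plugˡ Φ κ₂ ∘ κ₂   ≡⟨ cong (_∘ κ₂) cases-κ₂ ⟩
      (κ₂ ∘ ∇) ∘ κ₂     ∎)

  plugˡ-probability : ∀ {s : Hom I (I + I)} → ∇ ∘ s ≡ id → plugˡ Φ s ≡ [ s , κ₂ ]
  plugˡ-probability {s} ∇s = []-unique
    (trans (exchange Φ s κ₁) (trans (cong (_∘ s) plugʳ-κ₁) identityˡ))
    (trans (exchange Φ s κ₂) (trans (cong (_∘ s) plugʳ-κ₂) (fail-absorbs ∇s)))

  plugʳ-probability : ∀ {t : Hom I (I + I)} → ∇ ∘ t ≡ id → plugʳ Φ t ≡ [ t , κ₂ ]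
  plugʳ-probability {t} ∇t = []-unique
    (trans (sym (exchange Φ κ₁ t)) (trans (cong (_∘ t) cases-κ₁) identityˡ))
    (trans (sym (exchange Φ κ₂ t)) (trans (cong (_∘ t) cases-κ₂) (fail-absorbs ∇t)))

  product-commutes : ∀ {s t : Hom I (I + I)} → ∇ ∘ s ≡ id → ∇ ∘ t ≡ id →
                     [ s , κ₂ ] ∘ t ≡ [ t , κ₂ ] ∘ s
  product-commutes {s} {t} ∇s ∇t = begin
    [ s , κ₂ ] ∘ t   ≡⟨ cong (_∘ t) (sym (plugˡ-probability ∇s)) ⟩
    plugˡ Φ s ∘ t    ≡⟨ exchange Φ s t ⟩
    plugʳ Φ t ∘ s    ≡⟨ cong (_∘ s) (plugʳ-probability ∇t) ⟩
    [ t , κ₂ ] ∘ s   ∎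

theorem8p4 : ∀ {o ℓ : Level} (C : Category o ℓ) (K : FiniteCoproducts C) (M : SymmetricMonoidal C) → Distributive C K M → (s t : Category.Hom C (SymmetricMonoidal.I M) (FiniteCoproducts._+_ K (SymmetricMonoidal.I M) (SymmetricMonoidal.I M))) → IsProbability C K (SymmetricMonoidal.I M) s → IsProbability C K (SymmetricMonoidal.I M) t → prob-mul C K s t ≡ prob-mul C K t s
theorem8p4 C K M Dist s t s-prob t-prob = Product.product-commutes C K M Dist s-prob t-prob
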